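{- If $G$ is a connected cograph, then $\gamma_c(G)=\gamma_{\rm wcon}(G)$.
   Context: A cograph is a graph with no induced subgraph isomorphic to the path $P_4$ on four vertices. A set $D$ is dominating if every vertex outside $D$ has a neighbour in $D$; connected dominating if also $G[D]$ is connected; weakly convex if for any $a,b\in D$ some shortest $(a-b)$-path in $G$ lies in $D$. $\gamma_c(G)$, $\gamma_{\rm wcon}(G)$ denote the minimum sizes of a connected dominating set and a weakly convex dominating set. -}

module Defs where

open import Data.Nat using (ℕ; zero; suc; _≤_)
open import Data.Bool using (Bool; true; false)
open import Data.Fin using (Fin)
open import Data.Fin.Subset using (Subset; _∈_; _∉_; ∣_∣)
open import Data.Product using (Σ; ∃; ∃-syntax; _×_; _,_)
open import Relation.Binary.PropositionalEquality using (_≡_; _≢_)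
open import Relation.Nullary using (¬_)
open import Data.Unit using (⊤)

record Graph (n : ℕ) : Set where
  field
    adj    : Fin n → Fin n → Bool
    sym    : ∀ i j → adj i j ≡ adj j i
    irrefl : ∀ i → adj i i ≡ false

module _ {n : ℕ} (G : Graph n) where
  open Graph G

  Adj : Fin n → Fin n → Set
  Adj i j = adj i j ≡ true

  data Walk (S : Fin n → Set) : Fin n → Fin n → ℕ → Set where
    here : ∀ {a} → S a → Walk S a a 0
    step : ∀ {a b c ℓ} → S a → Adj a b → Walk S b c ℓ → Walk S a c (suc ℓ)

  Everywhere : Fin n → Set
  Everywhere _ = ⊤

  InSet : Subset n → Fin n → Set
  InSet D v = v ∈ D

  Connected : Set
  Connected = ∀ a b → ∃[ ℓ ] Walk Everywhere a b ℓ

  InducedP4 : Set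
  InducedP4 = Σ (Fin n) λ a → Σ (Fin n) λ b → Σ (Fin n) λ c → Σ (Fin n) λ d →
    (a ≢ b) × (a ≢ c) × (a ≢ d) × (b ≢ c) × (b ≢ d) × (c ≢ d) ×
    Adj a b × Adj b c × Adj c d ×
    adj a c ≡ false × adj b d ≡ false × adj a d ≡ false

  Cograph : Set
  Cograph = ¬ InducedP4

  Dominating : Subset n → Set
  Dominating D = ∀ v → v ∉ D → Σ (Fin n) λ u → u ∈ D × Adj u v

  InducedConnected : Subset n → Set
  InducedConnected D = ∀ a b → a ∈ D → b ∈ D → ∃[ ℓ ] Walk (InSet D) a b ℓ

  ConnectedDominating : Subset n → Set
  ConnectedDominating D = Dominating D × InducedConnected D

  -- ℓ is a shortest-path length between a and b in G, and some
  -- (a-b)-walk of that length lies in D (a shortest walk is a shortest path).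
  WeaklyConvex : Subset n → Set
  WeaklyConvex D = ∀ a b → a ∈ D → b ∈ D →
    ∃[ ℓ ] (Walk (InSet D) a b ℓ × (∀ m → Walk Everywhere a b m → ℓ ≤ m))

  WeaklyConvexDominating : Subset n → Set
  WeaklyConvexDominating D = Dominating D × WeaklyConvex D

  IsMinSize : (Subset n → Set) → ℕ → Set
  IsMinSize P k = (Σ (Subset n) λ D → P D × ∣ D ∣ ≡ k) × (∀ D → P D → k ≤ ∣ D ∣)

  IsConnDomNumber : ℕ → Set
  IsConnDomNumber = IsMinSize ConnectedDominating

  IsWConDomNumber : ℕ → Set
  IsWConDomNumber = IsMinSize WeaklyConvexDominating

-- In a cograph, any walk from a to b through a vertex set S can be shortened to a
-- walk of length at most 2 through S: prepending an edge a – x to a short walk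
-- x – c – b either yields a shortcut or an induced P4 a – x – c – b.  Hence for a
-- dominating set D both "G[D] is connected" and "D is weakly convex" say the same
-- thing, namely that any two vertices of D are at distance at most 2 inside D,
-- so the two minimisation problems have the same feasible sets.
module Submission where

open import Defs
open import Data.Nat using (ℕ; suc; _≤_; _<_; z≤n; s≤s; _≤?_)
open import Data.Nat.Properties using (≮⇒≥)
open import Data.Nat.Induction using (<-wellFounded)
open import Data.Product using (∃-syntax; _×_; Σ; _,_; proj₁; proj₂)
open import Data.Sum using (_⊎_; inj₁; inj₂)
open import Data.Bool using (true; false)
open import Data.Bool.Properties using () renaming (_≟_ to _≟ᵇ_)
open import Data.Empty using (⊥-elim)
open import Data.Fin using (Fin; _≟_)
open import Data.Fin.Subset using (Subset; _∈_; ∣_∣; ⊤)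
open import Data.Fin.Subset.Properties using (_∈?_; ∈⊤; anySubset?)
open import Data.Fin.Properties using (all?; any?)
open import Relation.Nullary using (¬_; Dec; yes; no)
open import Relation.Nullary.Decidable using (_×-dec_; _⊎-dec_; _→-dec_; ¬?)
open import Relation.Unary using (Decidable)
open import Relation.Binary.PropositionalEquality using (_≡_; _≢_; refl; sym; trans)
open import Induction.WellFounded using (Acc; acc)

module _ {n : ℕ} (G : Graph n) where
  open Graph G using (adj; irrefl)

  IsMinSize-exists : {P : Subset n → Set} → Decidable P →
    Σ (Subset n) P → ∃[ k ] IsMinSize G P k
  IsMinSize-exists {P} P? (D , pD) = go D pD (<-wellFounded ∣ D ∣)
    where
    go : ∀ D → P D → Acc _<_ ∣ D ∣ → ∃[ k ] IsMinSize G P k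
    go D pD (acc smaller) with anySubset? (λ D′ → P? D′ ×-dec (suc ∣ D′ ∣ ≤? ∣ D ∣))
    ... | yes (D′ , pD′ , D′<D) = go D′ pD′ (smaller D′<D)
    ... | no ¬smaller = ∣ D ∣ , (D , pD , refl) , λ D′ pD′ → ≮⇒≥ (λ D′<D → ¬smaller (D′ , pD′ , D′<D))

  IsMinSize-resp-⇔ : {P Q : Subset n → Set} → (∀ D → P D → Q D) → (∀ D → Q D → P D) →
    ∀ {k} → IsMinSize G P k → IsMinSize G Q k
  IsMinSize-resp-⇔ P⇒Q Q⇒P ((D , pD , ∣D∣≡k) , minimal) =
    (D , P⇒Q D pD , ∣D∣≡k) , λ D′ qD′ → minimal D′ (Q⇒P D′ qD′)

  adj? : ∀ a b → Dec (Adj G a b)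
  adj? a b = adj a b ≟ᵇ true

  Adj⇒≢ : ∀ {a b} → Adj G a b → a ≢ b
  Adj⇒≢ {a} a~b refl with trans (sym a~b) (irrefl a)
  ... | ()

  Walk-head : ∀ {S a b ℓ} → Walk G S a b ℓ → S a
  Walk-head (here sa)     = sa
  Walk-head (step sa _ _) = sa

  Walk-map : ∀ {S T : Fin n → Set} → (∀ {v} → S v → T v) →
    ∀ {a b ℓ} → Walk G S a b ℓ → Walk G T a b ℓ
  Walk-map f (here sa)       = here (f sa)
  Walk-map f (step sa a~x w) = step (f sa) a~x (Walk-map f w)

  walk-length-≥1 : ∀ {S a b m} → Walk G S a b m → a ≢ b → 1 ≤ m
  walk-length-≥1 (here _)     a≢b = ⊥-elim (a≢b refl)
  walk-length-≥1 (step _ _ _) a≢b = s≤s z≤n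

  walk-length-≥2 : ∀ {S a b m} → Walk G S a b m → a ≢ b → ¬ Adj G a b → 2 ≤ m
  walk-length-≥2 (here _)                 a≢b a≁b = ⊥-elim (a≢b refl)
  walk-length-≥2 (step _ a~b (here _))    a≢b a≁b = ⊥-elim (a≁b a~b)
  walk-length-≥2 (step _ _ (step _ _ _))  a≢b a≁b = s≤s (s≤s z≤n)

  Within₂ : (Fin n → Set) → Fin n → Fin n → Set
  Within₂ S a b = (a ≡ b) ⊎ Adj G a b ⊎ Σ (Fin n) λ c → S c × Adj G a c × Adj G c b

  Within₂? : ∀ D a b → Dec (Within₂ (InSet G D) a b)
  Within₂? D a b = (a ≟ b) ⊎-dec (adj? a b ⊎-dec any? λ c → (c ∈? D) ×-dec (adj? a c ×-dec adj? c b))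

  Within₂⇒Walk : ∀ {S a b} → S a → S b → Within₂ S a b → ∃[ ℓ ] Walk G S a b ℓ
  Within₂⇒Walk sa sb (inj₁ refl)                       = 0 , here sa
  Within₂⇒Walk sa sb (inj₂ (inj₁ a~b))                 = 1 , step sa a~b (here sb)
  Within₂⇒Walk sa sb (inj₂ (inj₂ (c , sc , a~c , c~b))) = 2 , step sa a~c (step sc c~b (here sb))

  Within₂⇒shortest : ∀ {S a b} → S a → S b → Within₂ S a b →
    ∃[ ℓ ] (Walk G S a b ℓ × (∀ m → Walk G (Everywhere G) a b m → ℓ ≤ m))
  Within₂⇒shortest {a = a} {b} sa sb near with a ≟ b | adj? a b | near
  ... | yes refl | _       | _          = 0 , here sa , λ _ _ → z≤n
  ... | no a≢b   | yes a~b | _          = 1 , step sa a~b (here sb) , λ _ w → walk-length-≥1 w a≢b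
  ... | no a≢b   | no _    | inj₁ a≡b   = ⊥-elim (a≢b a≡b)
  ... | no _     | no a≁b  | inj₂ (inj₁ a~b) = ⊥-elim (a≁b a~b)
  ... | no a≢b   | no a≁b  | inj₂ (inj₂ (c , sc , a~c , c~b)) =
    2 , step sa a~c (step sc c~b (here sb)) , λ _ w → walk-length-≥2 w a≢b a≁b

  Dominating? : ∀ D → Dec (Dominating G D)
  Dominating? D = all? λ v → ¬? (v ∈? D) →-dec any? λ u → (u ∈? D) ×-dec adj? u v

  DiameterTwoDominating : Subset n → Set
  DiameterTwoDominating D = Dominating G D × (∀ a b → a ∈ D → b ∈ D → Within₂ (InSet G D) a b)

  DiameterTwoDominating? : ∀ D → Dec (DiameterTwoDominating D)
  DiameterTwoDominating? D =
    Dominating? D ×-dec all? λ a → all? λ b → (a ∈? D) →-dec ((b ∈? D) →-dec Within₂? D a b)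

  DiameterTwoDominating⇒ConnectedDominating : ∀ D → DiameterTwoDominating D → ConnectedDominating G D
  DiameterTwoDominating⇒ConnectedDominating D (dom , near) =
    dom , λ a b a∈D b∈D → Within₂⇒Walk a∈D b∈D (near a b a∈D b∈D)

  DiameterTwoDominating⇒WeaklyConvexDominating : ∀ D → DiameterTwoDominating D → WeaklyConvexDominating G D
  DiameterTwoDominating⇒WeaklyConvexDominating D (dom , near) =
    dom , λ a b a∈D b∈D → Within₂⇒shortest a∈D b∈D (near a b a∈D b∈D)

  Connected⇒InducedConnected-⊤ : Connected G → InducedConnected G ⊤
  Connected⇒InducedConnected-⊤ conn a b _ _ with conn a b
  ... | ℓ , w = ℓ , Walk-map (λ _ → ∈⊤) w

  module _ (cog : Cograph G) where

    Within₂-cons : ∀ {S a x b} → Adj G a x → S x → Within₂ S x b → Within₂ S a b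
    Within₂-cons a~x sx (inj₁ refl) = inj₂ (inj₁ a~x)
    Within₂-cons {a = a} {x} {b} a~x sx (inj₂ (inj₁ x~b)) with a ≟ b | adj? a b
    ... | yes a≡b | _       = inj₁ a≡b
    ... | no _    | yes a~b = inj₂ (inj₁ a~b)
    ... | no _    | no _    = inj₂ (inj₂ (x , sx , a~x , x~b))
    Within₂-cons {a = a} {x} {b} a~x sx (inj₂ (inj₂ (c , sc , x~c , c~b)))
      with a ≟ b | a ≟ c
    ... | yes a≡b | _        = inj₁ a≡b
    ... | no _    | yes refl = inj₂ (inj₁ c~b)
    ... | no a≢b  | no a≢c   with adj a b in ab | adj a c in ac | adj x b in xb
    ... | true  | _     | _     = inj₂ (inj₁ refl)
    ... | false | true  | _     = inj₂ (inj₂ (c , sc , ac , c~b))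
    ... | false | false | true  = inj₂ (inj₂ (x , sx , a~x , xb))
    ... | false | false | false =
      ⊥-elim (cog (a , x , c , b , Adj⇒≢ a~x , a≢c , a≢b , Adj⇒≢ x~c , x≢b , Adj⇒≢ c~b ,
                   a~x , x~c , c~b , ac , xb , ab))
      where
      x≢b : x ≢ b
      x≢b refl with trans (sym a~x) ab
      ... | ()

    Walk⇒Within₂ : ∀ {S a b ℓ} → Walk G S a b ℓ → Within₂ S a b
    Walk⇒Within₂ (here _)       = inj₁ refl
    Walk⇒Within₂ (step _ a~x w) = Within₂-cons a~x (Walk-head w) (Walk⇒Within₂ w)

    ConnectedDominating⇒DiameterTwoDominating : ∀ D → ConnectedDominating G D → DiameterTwoDominating D
    ConnectedDominating⇒DiameterTwoDominating D (dom , conn) =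
      dom , λ a b a∈D b∈D → Walk⇒Within₂ (proj₂ (conn a b a∈D b∈D))

    WeaklyConvexDominating⇒DiameterTwoDominating : ∀ D → WeaklyConvexDominating G D → DiameterTwoDominating D
    WeaklyConvexDominating⇒DiameterTwoDominating D (dom , convex) =
      dom , λ a b a∈D b∈D → Walk⇒Within₂ (proj₁ (proj₂ (convex a b a∈D b∈D)))

corollary3p4 : (n : ℕ) (G : Graph (suc n)) → Connected G → Cograph G →
    ∃[ k ] (IsConnDomNumber G k × IsWConDomNumber G k)
corollary3p4 n G conn cog =
  let k , minimum = IsMinSize-exists G (DiameterTwoDominating? G) (⊤ , ⊤-feasible)
  in k , IsMinSize-resp-⇔ G (DiameterTwoDominating⇒ConnectedDominating G)
                            (ConnectedDominating⇒DiameterTwoDominating G cog) minimum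
       , IsMinSize-resp-⇔ G (DiameterTwoDominating⇒WeaklyConvexDominating G)
                            (WeaklyConvexDominating⇒DiameterTwoDominating G cog) minimum
  where
  ⊤-feasible : DiameterTwoDominating G ⊤
  ⊤-feasible = ConnectedDominating⇒DiameterTwoDominating G cog ⊤
    ((λ _ v∉⊤ → ⊥-elim (v∉⊤ ∈⊤)) , Connected⇒InducedConnected-⊤ G conn)
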